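{- (Löwenheim–Skolem theorem for graph models) For every graph model ${\cal G}$ there exists a sub graph model ${\cal P}$ of ${\cal G}$ with a countable carrier set such that ${\rm Ord}({\cal P})={\rm Ord}({\cal G})$, and hence ${\rm Eq}({\cal P})={\rm Eq}({\cal G})$.
   Context: A graph model is ${\cal G}=(G,c_{\cal G})$ with $G$ an infinite set and $c_{\cal G}:G^*\times G\to G$ injective and total ($G^*$ = finite subsets of $G$). Interpretation of $\lambda$-terms in ${\cal P}(G)$ for $\rho:Var\to{\cal P}(G)$: $x_\rho=\rho(x)$; $(MN)_\rho=\{\alpha:\exists a\subseteq N_\rho\text{ finite}, c_{\cal G}(a,\alpha)\in M_\rho\}$; $(\lambda x.M)_\rho=\{c_{\cal G}(a,\alpha):a\in G^*,\alpha\in M_{\rho[x:=a]}\}$. ${\rm Ord}({\cal G})=\{M\sqsubseteq N: M_\rho\subseteq N_\rho$ for all $\rho\}$ and ${\rm Eq}({\cal G})=\{M=N:M_\rho=N_\rho$ for all $\rho\}$. A graph model ${\cal P}$ is a sub graph model of ${\cal G}$ if $P\subseteq G$ and $c_{\cal P}$ is the restriction of $c_{\cal G}$ to $P^*\times P$. -}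

module Defs where

open import Data.Nat using (ℕ; _≟_)
open import Data.List using (List; map)
open import Data.List.Relation.Unary.All using (All)
open import Data.List.Membership.Propositional using (_∈_)
open import Data.Product using (Σ; _×_; _,_)
open import Relation.Binary.PropositionalEquality using (_≡_)
open import Relation.Nullary using (Dec; yes; no)
open import Function.Definitions using (Injective)

Var : Set
Var = ℕ

data Term : Set where
  var : Var → Term
  app : Term → Term → Term
  lam : Var → Term → Term

Pow : Set → Set₁
Pow G = G → Set

SameElems : {G : Set} → List G → List G → Set
SameElems a b = ∀ x → (x ∈ a → x ∈ b) × (x ∈ b → x ∈ a)

-- A graph model (G, c_G).  Finite subsets G* are represented by lists,
-- taken up to having the same elements (c must respect this, and its
-- injectivity is injectivity on finite *sets*).
record GraphModel : Set₁ where
  field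
    Carrier  : Set
    c        : List Carrier → Carrier → Carrier
    c-set    : ∀ {a b α} → SameElems a b → c a α ≡ c b α
    c-inj    : ∀ {a b α β} → c a α ≡ c b β → SameElems a b × α ≡ β
    infinite : Σ (ℕ → Carrier) (λ f → Injective _≡_ _≡_ f)

module _ (𝒢 : GraphModel) where
  open GraphModel 𝒢

  Env : Set₁
  Env = Var → Pow Carrier

  update : Env → Var → List Carrier → Env
  update ρ x a y with x ≟ y
  ... | yes _ = λ β → β ∈ a
  ... | no  _ = ρ y

  ⟦_⟧ : Term → Env → Pow Carrier
  ⟦ var x ⟧ ρ = ρ x
  ⟦ app M N ⟧ ρ α = Σ (List Carrier) λ a → All (⟦ N ⟧ ρ) a × ⟦ M ⟧ ρ (c a α)
  ⟦ lam x M ⟧ ρ β =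
    Σ (List Carrier) λ a → Σ Carrier λ α → (β ≡ c a α) × ⟦ M ⟧ (update ρ x a) α

  Ord : Term → Term → Set₁
  Ord M N = ∀ (ρ : Env) α → ⟦ M ⟧ ρ α → ⟦ N ⟧ ρ α

  Eq : Term → Term → Set₁
  Eq M N = ∀ (ρ : Env) α → (⟦ M ⟧ ρ α → ⟦ N ⟧ ρ α) × (⟦ N ⟧ ρ α → ⟦ M ⟧ ρ α)

open GraphModel

-- 𝒫 is a sub graph model of 𝒢: its carrier is (identified via the injection
-- ι with) a subset of G, and c_𝒫 is the restriction of c_𝒢.
record SubGraphModel (𝒢 : GraphModel) : Set₁ where
  field
    model : GraphModel
    ι     : Carrier model → Carrier 𝒢
    ι-inj : Injective _≡_ _≡_ ι
    ι-c   : ∀ a α → ι (c model a α) ≡ c 𝒢 (map ι a) (ι α)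

Countable : Set → Set
Countable A = Σ (A → ℕ) (λ f → Injective _≡_ _≡_ f)

-- Classical ambient logic (the paper works in classical set theory).
ExcludedMiddle : Set₂
ExcludedMiddle = (A : Set₁) → Dec A

{-# OPTIONS --safe #-}
-- Close the injective seed sequence of 𝒢 under c, under decomposition of c a α into a and α,
-- and under Skolem functions that choose, for each application M N, finite environment σ and
-- element α with α ∈ ⟦ M N ⟧σ, a witness list, and for each M, N with M ⋢ N a finite
-- counterexample.  Its elements are named by Skolem terms, so the hull is countable.  Since
-- ⟦ M ⟧ is continuous, every element of ⟦ M N ⟧ρ is already witnessed over a finite part of ρ,
-- so by induction on M the interpretation in the hull is the restriction of the one in 𝒢
-- (for environments valued in the hull).  Hence inequalities valid in 𝒢 stay valid in the
-- hull, and a failure in 𝒢 has a finite counterexample, which the hull contains.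
module Submission where

open import Defs
open import Data.Irrelevant using ([_])
open import Data.List using (List; []; _∷_; _++_; map; zip; filter)
open import Data.List.Membership.Propositional using (_∈_)
open import Data.List.Membership.Propositional.Properties
  using (∈-map⁺; ∈-map⁻; ∈-++⁺ˡ; ∈-++⁺ʳ; ∈-++⁻; ∈-filter⁺; ∈-filter⁻)
import Data.List.Relation.Binary.Subset.Propositional.Properties as Subset
open import Data.List.Relation.Unary.All as All using (All; []; _∷_)
import Data.List.Relation.Unary.All.Properties as All
open import Data.List.Relation.Unary.Any using (here; there)
open import Data.Nat using (ℕ; zero; suc; _≟_)
open import Data.Nat.Binary using (ℕᵇ; 2[1+_]; 1+[2_])
open import Data.Nat.Binary.Properties using (toℕ-injective; fromℕ-injective; 1+[2_]-injective)
import Data.Nat.Binary as ℕᵇ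
open import Data.Nat.Properties using (suc-injective)
open import Data.Product as Product using (Σ; _×_; _,_; proj₁; proj₂)
open import Data.Product.Function.NonDependent.Propositional using (_×-⇔_)
open import Data.Refinement using (Refinement-syntax; _,_; value; value-injective)
open import Data.Sum using (_⊎_; inj₁; inj₂; [_,_]′)
open import Data.Unit using (⊤; tt)
open import Function using (_∘_; id; const)
open import Function.Bundles using (_⇔_; mk⇔; Equivalence)
open import Function.Construct.Composition using (_⇔-∘_)
open import Function.Construct.Symmetry using (⇔-sym)
open import Function.Definitions using (Injective)
open import Level using (Lift; lift; lower)
open import Relation.Binary.PropositionalEquality using (_≡_; refl; cong; cong₂; sym; trans; subst)
open import Relation.Nullary using (Dec; yes; no; ¬_; ¬?; contradiction)
open import Relation.Nullary.Decidable using (map′; recompute)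

private
  variable
    A B : Set

pairᵇ : ℕ → ℕᵇ → ℕᵇ
pairᵇ zero    y = 2[1+ y ]
pairᵇ (suc a) y = 1+[2 pairᵇ a y ]

pairᵇ-injective : ∀ {a b y z} → pairᵇ a y ≡ pairᵇ b z → a ≡ b × y ≡ z
pairᵇ-injective {zero}  {zero}  refl = refl , refl
pairᵇ-injective {suc a} {suc b} e    =
  Product.map₁ (cong suc) (pairᵇ-injective (1+[2_]-injective e))
pairᵇ-injective {zero}  {suc _} ()
pairᵇ-injective {suc _} {zero}  ()

-- Opaque, so that pair a b ≡ pair c d determines the implicit arguments of pair-injective.
opaque
  pair : ℕ → ℕ → ℕ
  pair a b = ℕᵇ.toℕ (pairᵇ a (ℕᵇ.fromℕ b))

  pair-injective : ∀ {a b c d} → pair a b ≡ pair c d → a ≡ c × b ≡ d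
  pair-injective e = Product.map₂ fromℕ-injective (pairᵇ-injective (toℕ-injective e))

ℕ-countable : Countable ℕ
ℕ-countable = id , id

⊤-countable : Countable ⊤
⊤-countable = const 0 , λ _ → refl

×-countable : Countable A → Countable B → Countable (A × B)
×-countable (f , f-inj) (g , g-inj) =
  (λ (a , b) → pair (f a) (g b)) ,
  λ e → let a≡ , b≡ = pair-injective e in cong₂ _,_ (f-inj a≡) (g-inj b≡)

⊎-countable : Countable A → Countable B → Countable (A ⊎ B)
⊎-countable {A} {B} (f , f-inj) (g , g-inj) = encode , encode-injective
  where
  encode : A ⊎ B → ℕ
  encode (inj₁ a) = pair 0 (f a)
  encode (inj₂ b) = pair 1 (g b)

  encode-injective : Injective _≡_ _≡_ encode
  encode-injective {inj₁ _} {inj₁ _} e = cong inj₁ (f-inj (proj₂ (pair-injective e)))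
  encode-injective {inj₂ _} {inj₂ _} e = cong inj₂ (g-inj (proj₂ (pair-injective e)))
  encode-injective {inj₁ _} {inj₂ _} e with () ← proj₁ (pair-injective e)
  encode-injective {inj₂ _} {inj₁ _} e with () ← proj₁ (pair-injective e)

List-countable : Countable A → Countable (List A)
List-countable {A} (f , f-inj) = encode , encode-injective
  where
  encode : List A → ℕ
  encode []       = 0
  encode (x ∷ xs) = suc (pair (f x) (encode xs))

  encode-injective : Injective _≡_ _≡_ encode
  encode-injective {[]}     {[]}     _ = refl
  encode-injective {x ∷ xs} {y ∷ ys} e =
    let x≡ , xs≡ = pair-injective (suc-injective e) in cong₂ _∷_ (f-inj x≡) (encode-injective xs≡)
  encode-injective {[]}     {_ ∷ _}  ()
  encode-injective {_ ∷ _}  {[]}     ()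

data Tree (A : Set) : Set where
  node : A → List (Tree A) → Tree A

Tree-countable : Countable A → Countable (Tree A)
Tree-countable {A} (f , f-inj) = encode , encode-injective
  where
  encode : Tree A → ℕ
  -- List-countable's encoding, inlined for the termination checker.
  encodes : List (Tree A) → ℕ
  encode (node x ts) = pair (f x) (encodes ts)
  encodes []       = 0
  encodes (t ∷ ts) = suc (pair (encode t) (encodes ts))

  encode-injective : Injective _≡_ _≡_ encode
  encodes-injective : Injective _≡_ _≡_ encodes
  encode-injective {node x ts} {node y us} e =
    let x≡ , ts≡ = pair-injective e in cong₂ node (f-inj x≡) (encodes-injective ts≡)
  encodes-injective {[]}     {[]}     _ = refl
  encodes-injective {t ∷ ts} {u ∷ us} e =
    let t≡ , ts≡ = pair-injective (suc-injective e) in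
    cong₂ _∷_ (encode-injective t≡) (encodes-injective ts≡)
  encodes-injective {[]}     {_ ∷ _}  ()
  encodes-injective {_ ∷ _}  {[]}     ()

Term-countable : Countable Term
Term-countable = encode , encode-injective
  where
  encode : Term → ℕ
  encode (var x)   = pair 0 x
  encode (app M N) = pair 1 (pair (encode M) (encode N))
  encode (lam x M) = pair 2 (pair x (encode M))

  encode-injective : Injective _≡_ _≡_ encode
  encode-injective {var x}   {var y}   e = cong var (proj₂ (pair-injective e))
  encode-injective {app M N} {app M′ N′} e =
    let M≡ , N≡ = pair-injective (proj₂ (pair-injective e)) in
    cong₂ app (encode-injective M≡) (encode-injective N≡)
  encode-injective {lam x M} {lam y N} e =
    let x≡ , M≡ = pair-injective (proj₂ (pair-injective e)) in
    cong₂ lam x≡ (encode-injective M≡)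
  encode-injective {var _}   {app _ _} e with () ← proj₁ (pair-injective e)
  encode-injective {var _}   {lam _ _} e with () ← proj₁ (pair-injective e)
  encode-injective {app _ _} {var _}   e with () ← proj₁ (pair-injective e)
  encode-injective {app _ _} {lam _ _} e with () ← proj₁ (pair-injective e)
  encode-injective {lam _ _} {var _}   e with () ← proj₁ (pair-injective e)
  encode-injective {lam _ _} {app _ _} e with () ← proj₁ (pair-injective e)

image-countable : Countable B → (f : B → A) → (∀ a → Σ B λ b → f b ≡ a) → Countable A
image-countable (enc , enc-inj) f section =
  enc ∘ proj₁ ∘ section ,
  λ {a} {a′} e → trans (sym (proj₂ (section a))) (trans (cong f (enc-inj e)) (proj₂ (section a′)))

nth : A → List A → ℕ → A
nth d []       _       = d
nth d (x ∷ xs) zero    = x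
nth d (x ∷ xs) (suc i) = nth d xs i

∈⇒nth : ∀ {d x} {xs : List A} → x ∈ xs → Σ ℕ λ i → nth d xs i ≡ x
∈⇒nth (here refl) = 0 , refl
∈⇒nth (there x∈)  = let i , e = ∈⇒nth x∈ in suc i , e

zip-map-proj : (σ : List (A × B)) → zip (map proj₁ σ) (map proj₂ σ) ≡ σ
zip-map-proj []      = refl
zip-map-proj (p ∷ σ) = cong (p ∷_) (zip-map-proj σ)

∈-map⁻-injective : {f : A → B} → Injective _≡_ _≡_ f → ∀ {x xs} → f x ∈ map f xs → x ∈ xs
∈-map⁻-injective {f = f} f-inj fx∈ with ∈-map⁻ f fx∈
... | _ , x′∈ , fx≡fx′ = subst (_∈ _) (sym (f-inj fx≡fx′)) x′∈

SameElems-map : (f : A → B) → ∀ {xs ys} → SameElems xs ys → SameElems (map f xs) (map f ys)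
SameElems-map f xs≈ys _ =
  Subset.map⁺ f (λ {x} → proj₁ (xs≈ys x)) , Subset.map⁺ f (λ {x} → proj₂ (xs≈ys x))

SameElems-map⁻ : {f : A → B} → Injective _≡_ _≡_ f →
                 ∀ {xs ys} → SameElems (map f xs) (map f ys) → SameElems xs ys
SameElems-map⁻ {f = f} f-inj fxs≈fys x =
  ∈-map⁻-injective f-inj ∘ proj₁ (fxs≈fys (f x)) ∘ ∈-map⁺ f ,
  ∈-map⁻-injective f-inj ∘ proj₂ (fxs≈fys (f x)) ∘ ∈-map⁺ f

decide : ExcludedMiddle → (X : Set) → Dec X
decide em X = map′ lower lift (em (Lift _ X))

chosen : {X : Set} → Dec X → (X → List A) → List A
chosen (yes x) f = f x
chosen (no _)  _ = []

chosen-spec : ∀ {X : Set} {Q : A → Set} (X? : Dec X) (f : X → List A) →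
              X → All Q (chosen X? f) → Σ X λ x → All Q (f x)
chosen-spec (yes x) _ _ Qfx = x , Qfx
chosen-spec (no ¬x) _ x _   = contradiction x ¬x

Eq⇔Ord×Ord : ∀ 𝒜 M N → Eq 𝒜 M N ⇔ (Ord 𝒜 M N × Ord 𝒜 N M)
Eq⇔Ord×Ord 𝒜 M N =
  mk⇔ (λ M≡N → (λ ρ α → proj₁ (M≡N ρ α)) , (λ ρ α → proj₂ (M≡N ρ α)))
      (λ (M⊑N , N⊑M) ρ α → M⊑N ρ α , N⊑M ρ α)

Eq-transfer : ∀ {𝒜 ℬ} → (∀ M N → Ord 𝒜 M N ⇔ Ord ℬ M N) → ∀ M N → Eq 𝒜 M N ⇔ Eq ℬ M N
Eq-transfer {𝒜} {ℬ} Ord⇔ M N =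
  ⇔-sym (Eq⇔Ord×Ord ℬ M N) ⇔-∘ ((Ord⇔ M N ×-⇔ Ord⇔ N M) ⇔-∘ Eq⇔Ord×Ord 𝒜 M N)

module Continuity (𝒢 : GraphModel) where
  open GraphModel 𝒢 renaming (Carrier to G)

  ⟦_⟧ᴳ : Term → Env 𝒢 → Pow G
  ⟦_⟧ᴳ = ⟦_⟧ 𝒢

  infix 4 _⊆ᵉ_
  _⊆ᵉ_ : Env 𝒢 → Env 𝒢 → Set
  ρ ⊆ᵉ ρ′ = ∀ x {g} → ρ x g → ρ′ x g

  update-mono : ∀ {ρ ρ′} x a → ρ ⊆ᵉ ρ′ → update 𝒢 ρ x a ⊆ᵉ update 𝒢 ρ′ x a
  update-mono x a ρ⊆ρ′ y with x ≟ y
  ... | yes _ = id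
  ... | no  _ = ρ⊆ρ′ y

  ⟦⟧-mono : ∀ M {ρ ρ′ α} → ρ ⊆ᵉ ρ′ → ⟦ M ⟧ᴳ ρ α → ⟦ M ⟧ᴳ ρ′ α
  ⟦⟧-mono (var x)   ρ⊆ρ′ ρxα              = ρ⊆ρ′ x ρxα
  ⟦⟧-mono (app M N) ρ⊆ρ′ (a , Na , Mcaα)    = a , All.map (⟦⟧-mono N ρ⊆ρ′) Na , ⟦⟧-mono M ρ⊆ρ′ Mcaα
  ⟦⟧-mono (lam x M) ρ⊆ρ′ (a , α , β≡ , Mα) = a , α , β≡ , ⟦⟧-mono M (update-mono x a ρ⊆ρ′) Mα

  FinEnv : Set
  FinEnv = List (Var × G)

  ⟨_⟩ : FinEnv → Env 𝒢
  ⟨ σ ⟩ x g = (x , g) ∈ σ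

  FinSupported : (Env 𝒢 → Set) → Env 𝒢 → Set
  FinSupported Φ ρ = Σ FinEnv λ σ → ⟨ σ ⟩ ⊆ᵉ ρ × Φ ⟨ σ ⟩

  Monotone : (Env 𝒢 → Set) → Set₁
  Monotone Φ = ∀ {ρ ρ′} → ρ ⊆ᵉ ρ′ → Φ ρ → Φ ρ′

  FinSupported-× : ∀ {Φ Ψ ρ} → Monotone Φ → Monotone Ψ →
                   FinSupported Φ ρ → FinSupported Ψ ρ → FinSupported (λ ρ′ → Φ ρ′ × Ψ ρ′) ρ
  FinSupported-× Φ-mono Ψ-mono (σ , σ⊆ρ , Φσ) (τ , τ⊆ρ , Ψτ) =
    σ ++ τ ,
    (λ x → [ σ⊆ρ x , τ⊆ρ x ]′ ∘ ∈-++⁻ σ) ,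
    Φ-mono (λ _ → ∈-++⁺ˡ) Φσ ,
    Ψ-mono (λ _ → ∈-++⁺ʳ σ) Ψτ

  forget : Var → FinEnv → FinEnv
  forget x = filter (λ p → ¬? (x ≟ proj₁ p))

  forget-⊆ᵉ : ∀ {ρ σ} x a → ⟨ σ ⟩ ⊆ᵉ update 𝒢 ρ x a → ⟨ forget x σ ⟩ ⊆ᵉ ρ
  forget-⊆ᵉ x a σ⊆ y y∈ with ∈-filter⁻ (λ p → ¬? (x ≟ proj₁ p)) y∈
  ... | y∈σ , x≢y with x ≟ y | σ⊆ y y∈σ
  ...   | yes x≡y | _   = contradiction x≡y x≢y
  ...   | no  _   | ρyg = ρyg

  ⊆ᵉ-update-forget : ∀ {ρ σ} x a → ⟨ σ ⟩ ⊆ᵉ update 𝒢 ρ x a → ⟨ σ ⟩ ⊆ᵉ update 𝒢 ⟨ forget x σ ⟩ x a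
  ⊆ᵉ-update-forget x a σ⊆ y y∈σ with x ≟ y | σ⊆ y y∈σ
  ... | yes _   | g∈a = g∈a
  ... | no  x≢y | _   = ∈-filter⁺ (λ p → ¬? (x ≟ proj₁ p)) y∈σ x≢y

  All-mono : ∀ N {a} → Monotone (λ ρ → All (⟦ N ⟧ᴳ ρ) a)
  All-mono N ρ⊆ρ′ = All.map (⟦⟧-mono N ρ⊆ρ′)

  ⟦⟧-continuous : ∀ M {ρ α} → ⟦ M ⟧ᴳ ρ α → FinSupported (λ ρ′ → ⟦ M ⟧ᴳ ρ′ α) ρ
  All-continuous : ∀ N {ρ a} → All (⟦ N ⟧ᴳ ρ) a → FinSupported (λ ρ′ → All (⟦ N ⟧ᴳ ρ′) a) ρ

  ⟦⟧-continuous (var x) {α = α} ρxα =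
    (x , α) ∷ [] , (λ { _ (here refl) → ρxα ; _ (there ()) }) , here refl
  ⟦⟧-continuous (app M N) (a , Na , Mcaα) =
    let σ , σ⊆ρ , Naσ , Mcaασ =
          FinSupported-× (All-mono N) (⟦⟧-mono M) (All-continuous N Na) (⟦⟧-continuous M Mcaα)
    in σ , σ⊆ρ , a , Naσ , Mcaασ
  ⟦⟧-continuous (lam x M) (a , α , β≡ , Mα) =
    let σ , σ⊆ρ[x:=a] , Mασ = ⟦⟧-continuous M Mα
    in forget x σ , forget-⊆ᵉ x a σ⊆ρ[x:=a] ,
       a , α , β≡ , ⟦⟧-mono M (⊆ᵉ-update-forget x a σ⊆ρ[x:=a]) Mασ

  All-continuous N []        = [] , (λ _ ()) , []
  All-continuous N (Ng ∷ Na) =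
    let σ , σ⊆ρ , Ngσ , Naσ =
          FinSupported-× (⟦⟧-mono N) (All-mono N) (⟦⟧-continuous N Ng) (All-continuous N Na)
    in σ , σ⊆ρ , Ngσ ∷ Naσ

  Counterexample : Term → Term → Set
  Counterexample M N = Σ FinEnv λ σ → Σ G λ α → ⟦ M ⟧ᴳ ⟨ σ ⟩ α × ¬ ⟦ N ⟧ᴳ ⟨ σ ⟩ α

  counterexample-from : ∀ M N {ρ α} → ⟦ M ⟧ᴳ ρ α → ¬ ⟦ N ⟧ᴳ ρ α → Counterexample M N
  counterexample-from M N Mα ¬Nα =
    let σ , σ⊆ρ , Mασ = ⟦⟧-continuous M Mα in σ , _ , Mασ , ¬Nα ∘ ⟦⟧-mono N σ⊆ρ

module _ (𝒢 : GraphModel) where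
  open GraphModel 𝒢 renaming (Carrier to G)
  open Continuity 𝒢

  record Elementary (P : G → Set) : Set₁ where
    field
      seeds          : ∀ n → P (proj₁ infinite n)
      c-closed       : ∀ {a α} → All P a → P α → P (c a α)
      c-reflects     : ∀ {a α} → P (c a α) → All P a × P α
      app-witness    : ∀ M N {σ α} → All (P ∘ proj₂) σ → P α → ⟦ app M N ⟧ᴳ ⟨ σ ⟩ α →
                       Σ (List G) λ a → All P a × All (⟦ N ⟧ᴳ ⟨ σ ⟩) a × ⟦ M ⟧ᴳ ⟨ σ ⟩ (c a α)
      counterexample : ∀ M N → Counterexample M N →
                       Σ FinEnv λ σ → Σ G λ α →
                         All (P ∘ proj₂) σ × P α × ⟦ M ⟧ᴳ ⟨ σ ⟩ α × ¬ ⟦ N ⟧ᴳ ⟨ σ ⟩ α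

module ElementarySubmodel (em : ExcludedMiddle) {𝒢 : GraphModel} {P : GraphModel.Carrier 𝒢 → Set}
                          (P-elementary : Elementary 𝒢 P) where
  open GraphModel 𝒢 renaming (Carrier to G)
  open Continuity 𝒢
  open Elementary P-elementary

  Point : Set
  Point = [ g ∈ G ∣ P g ]

  -- Proofs are stored irrelevantly, so that value is injective, and recomputed by excluded middle.
  membership : (q : Point) → P (value q)
  membership (_ , [ Pg ]) = recompute (decide em _) Pg

  memberships : (qs : List Point) → All P (map value qs)
  memberships qs = All.map⁺ (All.tabulate λ {q} _ → membership q)

  points : ∀ {a} → All P a → Σ (List Point) λ qs → map value qs ≡ a
  points []        = [] , refl
  points (Pg ∷ Pa) = let qs , e = points Pa in (_ , [ Pg ]) ∷ qs , cong (_ ∷_) e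

  cᴾ : List Point → Point → Point
  cᴾ a α = c (map value a) (value α) , [ c-closed (memberships a) (membership α) ]

  𝒫 : GraphModel
  𝒫 = record
    { Carrier  = Point
    ; c        = cᴾ
    ; c-set    = λ a≈b → value-injective (c-set (SameElems-map value a≈b))
    ; c-inj    = λ e → let a≈b , α≡β = c-inj (cong value e)
                       in SameElems-map⁻ value-injective a≈b , value-injective α≡β
    ; infinite = (λ n → proj₁ infinite n , [ seeds n ]) , λ e → proj₂ infinite (cong value e)
    }

  submodel : SubGraphModel 𝒢
  submodel = record { model = 𝒫 ; ι = value ; ι-inj = value-injective ; ι-c = λ _ _ → refl }

  ⟦_⟧ᴾ : Term → Env 𝒫 → Pow Point
  ⟦_⟧ᴾ = ⟦_⟧ 𝒫

  infix 4 _≈ᵉ_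
  _≈ᵉ_ : Env 𝒫 → Env 𝒢 → Set
  ρᴾ ≈ᵉ ρ = (∀ x q → ρᴾ x q ⇔ ρ x (value q)) × (∀ x {g} → ρ x g → P g)

  values-in-P : ∀ {ρᴾ ρ σ} → ρᴾ ≈ᵉ ρ → ⟨ σ ⟩ ⊆ᵉ ρ → All (P ∘ proj₂) σ
  values-in-P (_ , supported) σ⊆ρ = All.tabulate λ {(x , _)} x∈ → supported x (σ⊆ρ x x∈)

  update-≈ᵉ : ∀ {ρᴾ ρ} → ρᴾ ≈ᵉ ρ → ∀ x qs → update 𝒫 ρᴾ x qs ≈ᵉ update 𝒢 ρ x (map value qs)
  update-≈ᵉ {ρᴾ} {ρ} (agree , supported) x qs = agree′ , supported′
    where
    agree′ : ∀ y q → update 𝒫 ρᴾ x qs y q ⇔ update 𝒢 ρ x (map value qs) y (value q)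
    agree′ y q with x ≟ y
    ... | yes _ = mk⇔ (∈-map⁺ value) (∈-map⁻-injective value-injective)
    ... | no  _ = agree y q

    supported′ : ∀ y {g} → update 𝒢 ρ x (map value qs) y g → P g
    supported′ y with x ≟ y
    ... | yes _ = λ g∈ → let q , _ , g≡ = ∈-map⁻ value g∈ in subst P (sym g≡) (membership q)
    ... | no  _ = supported y

  simulation : ∀ M {ρᴾ ρ} → ρᴾ ≈ᵉ ρ → ∀ q → ⟦ M ⟧ᴾ ρᴾ q ⇔ ⟦ M ⟧ᴳ ρ (value q)
  simulation (var x) (agree , _) q = agree x q
  simulation (app M N) {ρᴾ} {ρ} ρᴾ≈ρ q = mk⇔ to from
    where
    to : ⟦ app M N ⟧ᴾ ρᴾ q → ⟦ app M N ⟧ᴳ ρ (value q)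
    to (qs , Nqs , Mcqs) =
      map value qs ,
      All.map⁺ (All.map (Equivalence.to (simulation N ρᴾ≈ρ _)) Nqs) ,
      Equivalence.to (simulation M ρᴾ≈ρ _) Mcqs

    from : ⟦ app M N ⟧ᴳ ρ (value q) → ⟦ app M N ⟧ᴾ ρᴾ q
    from MNα with ⟦⟧-continuous (app M N) MNα
    ... | σ , σ⊆ρ , MNασ with app-witness M N (values-in-P ρᴾ≈ρ σ⊆ρ) (membership q) MNασ
    ... | a , Pa , Na , Mcaα with points Pa
    ... | qs , refl =
      qs ,
      All.map (Equivalence.from (simulation N ρᴾ≈ρ _)) (All.map⁻ (All.map (⟦⟧-mono N σ⊆ρ) Na)) ,
      Equivalence.from (simulation M ρᴾ≈ρ _) (⟦⟧-mono M σ⊆ρ Mcaα)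
  simulation (lam x M) {ρᴾ} {ρ} ρᴾ≈ρ q = mk⇔ to from
    where
    to : ⟦ lam x M ⟧ᴾ ρᴾ q → ⟦ lam x M ⟧ᴳ ρ (value q)
    to (qs , q′ , q≡ , Mq′) =
      map value qs , value q′ , cong value q≡ ,
      Equivalence.to (simulation M (update-≈ᵉ ρᴾ≈ρ x qs) q′) Mq′

    from : ⟦ lam x M ⟧ᴳ ρ (value q) → ⟦ lam x M ⟧ᴾ ρᴾ q
    from (a , α , q≡ , Mα) with c-reflects (subst P q≡ (membership q))
    ... | Pa , Pα with points Pa
    ... | qs , refl =
      qs , (α , [ Pα ]) , value-injective q≡ ,
      Equivalence.from (simulation M (update-≈ᵉ ρᴾ≈ρ x qs) (α , [ Pα ])) Mα

  restrict : (ρ : Env 𝒢) → (∀ x {g} → ρ x g → P g) → Σ (Env 𝒫) (_≈ᵉ ρ)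
  restrict ρ ρ⊆P = (λ x q → ρ x (value q)) , (λ _ _ → mk⇔ id id) , ρ⊆P

  extend : (ρᴾ : Env 𝒫) → Σ (Env 𝒢) (ρᴾ ≈ᵉ_)
  extend ρᴾ = (λ x g → Σ (P g) λ Pg → ρᴾ x (g , [ Pg ])) ,
              (λ _ q → mk⇔ (membership q ,_) proj₂) ,
              (λ _ → proj₁)

  Ord-preserved : ∀ M N → Ord 𝒢 M N → Ord 𝒫 M N
  Ord-preserved M N M⊑N ρᴾ q =
    let ρ , ρᴾ≈ρ = extend ρᴾ in
    Equivalence.from (simulation N ρᴾ≈ρ q) ∘ M⊑N ρ (value q) ∘ Equivalence.to (simulation M ρᴾ≈ρ q)

  Ord-reflected : ∀ M N → Ord 𝒫 M N → Ord 𝒢 M N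
  Ord-reflected M N M⊑N ρ α Mα with decide em (⟦ N ⟧ᴳ ρ α)
  ... | yes Nα = Nα
  ... | no ¬Nα =
    let σ , α′ , Pσ , Pα′ , Mα′ , ¬Nα′ = counterexample M N (counterexample-from M N Mα ¬Nα)
        ρᴾ , ρᴾ≈σ = restrict ⟨ σ ⟩ (λ _ → All.lookup Pσ)
        q = α′ , [ Pα′ ]
    in contradiction (Equivalence.to (simulation N ρᴾ≈σ q)
                        (M⊑N ρᴾ q (Equivalence.from (simulation M ρᴾ≈σ q) Mα′)))
                     ¬Nα′

  Ord⇔ : ∀ M N → Ord 𝒫 M N ⇔ Ord 𝒢 M N
  Ord⇔ M N = mk⇔ (Ord-reflected M N) (Ord-preserved M N)

Query : Set
Query = ℕ ⊎ ⊤ ⊎ ⊤ ⊎ (Term × Term × List Var) ⊎ (Term × Term)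

pattern seed n         = inj₁ n
pattern build          = inj₂ (inj₁ tt)
pattern decompose      = inj₂ (inj₂ (inj₁ tt))
pattern witness M N xs = inj₂ (inj₂ (inj₂ (inj₁ (M , N , xs))))
pattern refute M N     = inj₂ (inj₂ (inj₂ (inj₂ (M , N))))

Query-countable : Countable Query
Query-countable =
  ⊎-countable ℕ-countable (⊎-countable ⊤-countable (⊎-countable ⊤-countable (⊎-countable
    (×-countable Term-countable (×-countable Term-countable (List-countable ℕ-countable)))
    (×-countable Term-countable Term-countable))))

SkolemTerm : Set
SkolemTerm = Tree (Query × ℕ)

SkolemTerm-countable : Countable SkolemTerm
SkolemTerm-countable = Tree-countable (×-countable Query-countable ℕ-countable)

module SkolemHull (em : ExcludedMiddle) (𝒢 : GraphModel) where
  open GraphModel 𝒢 renaming (Carrier to G)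
  open Continuity 𝒢

  Decomposition : G → Set
  Decomposition g = Σ (List G) λ a → Σ G λ α → g ≡ c a α

  components : ∀ {g} → Decomposition g → List G
  components (a , α , _) = α ∷ a

  counterexample-points : ∀ {M N} → Counterexample M N → List G
  counterexample-points (σ , α , _) = α ∷ map proj₂ σ

  skolem : Query → List G → List G
  skolem (seed n)         _        = proj₁ infinite n ∷ []
  skolem build            (α ∷ a)  = c a α ∷ []
  skolem decompose        (g ∷ _)  = chosen (decide em (Decomposition g)) components
  skolem (witness M N xs) (α ∷ gs) = chosen (decide em (⟦ app M N ⟧ᴳ ⟨ zip xs gs ⟩ α)) proj₁
  skolem (refute M N)     _        =
    chosen (decide em (Counterexample M N)) (counterexample-points {M} {N})
  skolem _                []       = []

  -- node (q , i) ts denotes the i-th value of the Skolem function q at the values of ts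
  -- (an arbitrary seed when i is out of range).
  eval : SkolemTerm → G
  evals : List SkolemTerm → List G
  eval (node (q , i) ts) = nth (proj₁ infinite 0) (skolem q (evals ts)) i
  evals []       = []
  evals (t ∷ ts) = eval t ∷ evals ts

  InHull : G → Set
  InHull g = Σ SkolemTerm λ t → eval t ≡ g

  terms : ∀ {gs} → All InHull gs → Σ (List SkolemTerm) λ ts → evals ts ≡ gs
  terms []                = [] , refl
  terms ((t , refl) ∷ hs) = let ts , e = terms hs in t ∷ ts , cong (eval t ∷_) e

  skolem-closed : ∀ q {gs} → All InHull gs → All InHull (skolem q gs)
  skolem-closed q hs with terms hs
  ... | ts , refl = All.tabulate λ x∈ → let i , e = ∈⇒nth x∈ in node (q , i) ts , e

  c-reflects : ∀ {a α} → InHull (c a α) → All InHull a × InHull α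
  c-reflects {a} {α} h
    with chosen-spec (decide em (Decomposition (c a α))) components (a , α , refl)
                     (skolem-closed decompose (h ∷ []))
  ... | (a′ , α′ , e) , hα′ ∷ ha′ with c-inj e
  ... | a≈a′ , refl = All.tabulate (All.lookup ha′ ∘ proj₁ (a≈a′ _)) , hα′

  app-witness : ∀ M N {σ α} → All (InHull ∘ proj₂) σ → InHull α → ⟦ app M N ⟧ᴳ ⟨ σ ⟩ α →
                Σ (List G) λ a → All InHull a × All (⟦ N ⟧ᴳ ⟨ σ ⟩) a × ⟦ M ⟧ᴳ ⟨ σ ⟩ (c a α)
  app-witness M N {σ} hσ hα = witness-closed (map proj₁ σ) (zip-map-proj σ) (hα ∷ All.map⁺ hσ)
    where
    witness-closed : ∀ {σ α} xs {gs} → zip xs gs ≡ σ → All InHull (α ∷ gs) → ⟦ app M N ⟧ᴳ ⟨ σ ⟩ α →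
                     Σ (List G) λ a → All InHull a × All (⟦ N ⟧ᴳ ⟨ σ ⟩) a × ⟦ M ⟧ᴳ ⟨ σ ⟩ (c a α)
    witness-closed xs refl hs MNα =
      let (a , Na , Mcaα) , ha =
            chosen-spec (decide em _) proj₁ MNα (skolem-closed (witness M N xs) hs)
      in a , ha , Na , Mcaα

  counterexample : ∀ M N → Counterexample M N →
                   Σ FinEnv λ σ → Σ G λ α →
                     All (InHull ∘ proj₂) σ × InHull α × ⟦ M ⟧ᴳ ⟨ σ ⟩ α × ¬ ⟦ N ⟧ᴳ ⟨ σ ⟩ α
  counterexample M N ce
    with chosen-spec (decide em (Counterexample M N)) (counterexample-points {M} {N}) ce
                     (skolem-closed (refute M N) [])
  ... | (σ , α , Mα , ¬Nα) , hα ∷ hσ = σ , α , All.map⁻ hσ , hα , Mα , ¬Nα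

  elementary : Elementary 𝒢 InHull
  elementary = record
    { seeds          = λ n → All.head (skolem-closed (seed n) [])
    ; c-closed       = λ ha hα → All.head (skolem-closed build (hα ∷ ha))
    ; c-reflects     = c-reflects
    ; app-witness    = app-witness
    ; counterexample = counterexample
    }

  open ElementarySubmodel em elementary public

  countable : Countable Point
  countable =
    image-countable SkolemTerm-countable (λ t → eval t , [ t , refl ])
      λ q → let t , t≡ = membership q in t , value-injective t≡

theorem8 : ExcludedMiddle → (𝒢 : GraphModel) →
    Σ (SubGraphModel 𝒢) λ 𝒫 →
      Countable (GraphModel.Carrier (SubGraphModel.model 𝒫))
      × (∀ M N → Ord (SubGraphModel.model 𝒫) M N ⇔ Ord 𝒢 M N)
      × (∀ M N → Eq (SubGraphModel.model 𝒫) M N ⇔ Eq 𝒢 M N)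
theorem8 em 𝒢 = submodel , countable , Ord⇔ , Eq-transfer Ord⇔
  where open SkolemHull em 𝒢
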